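{- Let $M,N\in\Lambda^{001}_\infty$. If $M\to_\beta^\infty N$, then $\mathcal{T}(M)\mathrel{\widetilde{\to}_r^*}\mathcal{T}(N)$, i.e. there exist an index set $I$, resource terms $(s_i)_{i\in I}$ and finite sums $(T_i)_{i\in I}$ such that $\mathcal{T}(M)=\bigcup_{i\in I}\{s_i\}$, $\mathcal{T}(N)=\bigcup_{i\in I}T_i$, and $s_i\to_r^* T_i$ for every $i\in I$.
   Context: Fix an infinite set $\mathcal V$ of variables. $\Lambda^{001}_\infty$ is the set of 001-infinitary λ-terms: possibly infinite syntax trees built from variables $x\in\mathcal V$, abstractions $\lambda x.M$ and applications $(M)N$, in which every infinite branch passes infinitely often through the argument (right) subterm of an application; formally $\Lambda^{001}_\infty=\nu Y.\mu X.(\mathcal V+\lambda\mathcal V.X+(X)Y)$. Terms are taken up to α-equivalence, and fresh variables are assumed always available. Substitution $M[N/x]$ is the usual capture-avoiding substitution (defined corecursively). $\to_\beta$ is the contextual closure of $\beta_0=\{((\lambda x.M)N,\,M[N/x])\}$: $M\to_\beta N$ if $M\,\beta_0\,N$, and if $M\to_\beta N$ then $\lambda x.M\to_\beta\lambda x.N$, $(M)P\to_\beta(N)P$, $(P)M\to_\beta(P)N$ (inductive definition). $\to_\beta^*$ is its reflexive–transitive closure. The infinitary reduction $\to_\beta^\infty$ (001-strongly convergent closure of $\to_\beta^*$) is given by the rules: (i) $M\to_\beta^\infty x$ if $M\to_\beta^*x$; (ii) $M\to_\beta^\infty\lambda x.P'$ if $M\to_\beta^*\lambda x.P$ and $P\to_\beta^\infty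 P'$; (iii) $M\to_\beta^\infty(P')Q'$ if $M\to_\beta^*(P)Q$, $P\to_\beta^\infty P'$ and $Q\to_\beta^\infty Q'$; derivations may be infinite, but every infinite branch must pass infinitely often through the premise $Q\to_\beta^\infty Q'$ of rule (iii). Resource calculus: resource terms $s::=x\mid\lambda x.s\mid\langle s\rangle\bar t$ where monomials $\bar t=[t_1,\dots,t_n]$ are finite multisets of resource terms ($1$ is the empty multiset, multiset union is written $\cdot$). A "finite sum" is a finite set of resource terms written additively ($0$ is the empty set, $+$ is union); constructors extend to sums by linearity. Resource substitution: $s\langle\bar t/x\rangle=\sum_{\sigma\in\mathfrak S_n}s[t_{\sigma(i)}/x_i]$ if $x$ has exactly $n$ free occurrences $x_1,\dots,x_n$ in $s$, and $0$ otherwise. $\mapsto_r$ is the least relation with $\langle\lambda x.s\rangle\bar t\mapsto_r s\langle\bar t/x\rangle$, closed under: $s\mapsto_r S$ implies $\lambda x.s\mapsto_r\lambda x.S$, $\langle s\rangle\bar t\mapsto_r\langle S\rangle\bar t$, and $s\cdot\bar t\mapsto_r S\cdot\bar t$; $\bar t\mapsto_r\bar T$ implies $\langle s\rangle\bar t\mapsto_r\langle s\rangle\bar T$. On finite sums: $\sum_{i=0}^n s_i\to_r\sum_{i=0}^nT_i$ whenever $s_0\mapsto_rT_0$ and for each $1\le i\le n$ either $s_i\mapsto_rT_i$ or $T_i=s_i$; $\to_r^*$ is the reflexive–transitive closure. Taylor approximation $\ltimes\subseteq$ resource terms $\times\Lambda^{001}_\infty$ is defined inductively: $x\ltimes x$;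 $\lambda x.s\ltimes\lambda x.M$ if $s\ltimes M$; $\langle s\rangle[t_1,\dots,t_n]\ltimes(M)N$ if $s\ltimes M$ and $t_i\ltimes N$ for all $i$ ($n\ge0$). The Taylor expansion is $\mathcal T(M)=\{s\mid s\ltimes M\}$ (a possibly infinite set). -}

module Defs where

open import Data.Nat using (ℕ; zero; suc; pred; _≟_; compare; less; equal; greater; _+_; _<ᵇ_; _≡ᵇ_)
open import Data.Bool using (true; false)
open import Data.List using (List; []; _∷_; _++_; map; concat; concatMap; length)
open import Data.List.Relation.Unary.All using (All)
open import Data.List.Relation.Unary.Any using (Any)
open import Data.List.Relation.Binary.Pointwise using (Pointwise)
open import Data.Product using (Σ; Σ-syntax; ∃; ∃-syntax; _×_; _,_; proj₁; proj₂)
open import Data.Sum using (_⊎_)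
open import Relation.Nullary using (yes; no; ¬_)
open import Relation.Binary.PropositionalEquality using (_≡_)
open import Relation.Binary.Construct.Closure.ReflexiveTransitive using (Star)
open import Function.Bundles using (_⇔_)

-- 001-infinitary λ-terms  Λ^{001}_∞ = νY.μX.(V + λV.X + (X)Y)
--
-- Equality of infinite terms (bisimilarity) is
-- pointwise equality of labellings.

data Dir : Set where
  body left right : Dir     -- body of λ, function part, argument part

Address : Set
Address = List Dir

data Label : Set where
  var  : ℕ → Label
  lam  : Label
  app  : Label
  none : Label

Tree : Set
Tree = Address → Label

subtree : Address → Tree → Tree
subtree p t q = t (p ++ q)

child : Dir → Tree → Tree
child d t q = t (d ∷ q)

_∷ʳ'_ : Address → Dir → Address
p ∷ʳ' d = p ++ (d ∷ [])

varT : ℕ → Tree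
varT x [] = var x
varT x (_ ∷ _) = none

lamT : Tree → Tree
lamT b [] = lam
lamT b (body ∷ p) = b p
lamT b (left ∷ p) = none
lamT b (right ∷ p) = none

appT : Tree → Tree → Tree
appT f a [] = app
appT f a (body ∷ p) = none
appT f a (left ∷ p) = f p
appT f a (right ∷ p) = a p

_≈_ : Tree → Tree → Set
t ≈ u = ∀ p → t p ≡ u p

-- well-formedness: a tree with correct arities ...
ChildOK : Label → Label → Dir → Set
ChildOK (var _) c d = c ≡ none
ChildOK none c d = c ≡ none
ChildOK lam c body = ¬ (c ≡ none)
ChildOK lam c left = c ≡ none
ChildOK lam c right = c ≡ none
ChildOK app c body = c ≡ none
ChildOK app c left = ¬ (c ≡ none)
ChildOK app c right = ¬ (c ≡ none)

-- ... in which from every node the path following only λ-bodies and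
-- function parts is finite (μX inside νY: every infinite branch goes
-- through an argument position infinitely often)
data Spine (t : Tree) : Address → Set where
  svar : ∀ {p x} → t p ≡ var x → Spine t p
  slam : ∀ {p} → t p ≡ lam → Spine t (p ∷ʳ' body) → Spine t p
  sapp : ∀ {p} → t p ≡ app → Spine t (p ∷ʳ' left) → Spine t p

WF : Tree → Set
WF t = (¬ (t [] ≡ none))
     × (∀ p d → ChildOK (t p) (t (p ∷ʳ' d)) d)
     × (∀ p → ¬ (t p ≡ none) → Spine t p)

bump : Dir → ℕ
bump body = 1
bump left = 0
bump right = 0

-- label at address p of N with free variables (≥ j, j = binder depth
-- inside N) shifted by k
shiftAt : ℕ → ℕ → Tree → Address → Label
shiftAt k j N [] with N []
... | var y with y <ᵇ j
...   | true = var y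
...   | false = var (y + k)
shiftAt k j N [] | lam = lam
shiftAt k j N [] | app = app
shiftAt k j N [] | none = none
shiftAt k j N (d ∷ p) = shiftAt k (j + bump d) (child d N) p

-- label at address p of M[N/x] where x has de Bruijn index k in M
-- (k = number of binders crossed); the binder of x is removed
subAt : ℕ → Tree → Tree → Address → Label
subAt k M N [] with M []
... | var x with compare x k
...   | less _ _ = var x
...   | equal _ = shiftAt k 0 N []
...   | greater _ _ = var (pred x)
subAt k M N [] | lam = lam
subAt k M N [] | app = app
subAt k M N [] | none = none
subAt k M N (d ∷ p) with M []
... | var x with x ≡ᵇ k
...   | true = shiftAt k 0 N (d ∷ p)
...   | false = none
subAt k M N (d ∷ p) | lam = subAt (k + bump d) (child d M) N p
subAt k M N (d ∷ p) | app = subAt (k + bump d) (child d M) N p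
subAt k M N (d ∷ p) | none = none

-- M [ N /0] : substitute N for the variable bound by the removed
-- outermost λ of M (index 0)
_[_/0] : Tree → Tree → Tree
M [ N /0] = subAt 0 M N

data _→β_ : Tree → Tree → Set where
  β₀   : ∀ {M N} → appT (lamT M) N →β (M [ N /0])
  lamβ : ∀ {M M'} → M →β M' → lamT M →β lamT M'
  appL : ∀ {M M' N} → M →β M' → appT M N →β appT M' N
  appR : ∀ {M N N'} → N →β N' → appT M N →β appT M N'

-- reflexive-transitive closure, working modulo bisimilarity
_⇝_ : Tree → Tree → Set
M ⇝ N = (M ≈ N) ⊎ (M →β N)

_→β*_ : Tree → Tree → Set
_→β*_ = Star _⇝_

-- A derivation of M →β∞ N has exactly the shape of N; it is given by the
-- family R of left-hand sides of its judgements R p →β∞ (subtree p N),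
-- indexed by the addresses p of N, each node using rule (i), (ii) or
-- (iii) according to the label of N at p.  Since N ∈ Λ^{001}_∞, every
-- infinite branch passes infinitely often through the right premise.
Node : Tree → (Address → Tree) → Address → Set
Node N R p =
    (∀ x → N p ≡ var x → R p →β* varT x)
  × (N p ≡ lam → R p →β* lamT (R (p ∷ʳ' body)))
  × (N p ≡ app → R p →β* appT (R (p ∷ʳ' left)) (R (p ∷ʳ' right)))

_→β∞_ : Tree → Tree → Set
M →β∞ N = Σ[ R ∈ (Address → Tree) ] ((R [] ≈ M) × (∀ p → Node N R p))

-- Resource calculus (de Bruijn indices). Monomials are lists taken up
-- to permutation (see _≅ₘ_); finite sums are lists taken as sets.

data RTerm : Set where
  rvar : ℕ → RTerm
  rlam : RTerm → RTerm
  rapp : RTerm → List RTerm → RTerm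

Bag : Set
Bag = List RTerm

FSum : Set
FSum = List RTerm

mutual
  data _≅_ : RTerm → RTerm → Set where
    rvar : ∀ {x} → rvar x ≅ rvar x
    rlam : ∀ {s s'} → s ≅ s' → rlam s ≅ rlam s'
    rapp : ∀ {s s' ts ts'} → s ≅ s' → ts ≅ₘ ts' → rapp s ts ≅ rapp s' ts'

  data _≅ₘ_ : Bag → Bag → Set where
    []   : [] ≅ₘ []
    cons : ∀ {s t ss ts₁ ts₂} → s ≅ t → ss ≅ₘ (ts₁ ++ ts₂) →
           (s ∷ ss) ≅ₘ (ts₁ ++ t ∷ ts₂)

_∈ₛ_ : RTerm → FSum → Set
u ∈ₛ S = Any (u ≅_) S

_≋_ : FSum → FSum → Set
S ≋ S' = ∀ u → (u ∈ₛ S) ⇔ (u ∈ₛ S')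

ext : (ℕ → ℕ) → ℕ → ℕ
ext ρ zero = zero
ext ρ (suc x) = suc (ρ x)

mutual
  rren : (ℕ → ℕ) → RTerm → RTerm
  rren ρ (rvar x) = rvar (ρ x)
  rren ρ (rlam s) = rlam (rren (ext ρ) s)
  rren ρ (rapp s ts) = rapp (rren ρ s) (rrenB ρ ts)

  rrenB : (ℕ → ℕ) → Bag → Bag
  rrenB ρ [] = []
  rrenB ρ (t ∷ ts) = rren ρ t ∷ rrenB ρ ts

mutual
  occ : ℕ → RTerm → ℕ
  occ k (rvar x) with x ≟ k
  ... | yes _ = 1
  ... | no _ = 0
  occ k (rlam s) = occ (suc k) s
  occ k (rapp s ts) = occ k s + occB k ts

  occB : ℕ → Bag → ℕ
  occB k [] = 0
  occB k (t ∷ ts) = occ k t + occB k ts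

-- plug k s us : replace the free occurrences x_1, x_2, … (left to right)
-- of the variable with index k in s by us = u_1, u_2, … respectively,
-- removing the binder of that variable; returns the unused rest of us.
mutual
  plug : ℕ → RTerm → List RTerm → RTerm × List RTerm
  plug k (rvar x) us with compare x k
  plug k (rvar x) us | less _ _ = rvar x , us
  plug k (rvar .k) [] | equal _ = rvar k , []
  plug k (rvar .k) (u ∷ us) | equal _ = rren (k +_) u , us
  plug k (rvar x) us | greater _ _ = rvar (pred x) , us
  plug k (rlam s) us with plug (suc k) s us
  ... | s' , us' = rlam s' , us'
  plug k (rapp s ts) us with plug k s us
  ... | s' , us₁ with plugB k ts us₁
  ... | ts' , us₂ = rapp s' ts' , us₂

  plugB : ℕ → Bag → List RTerm → Bag × List RTerm
  plugB k [] us = [] , us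
  plugB k (t ∷ ts) us with plug k t us
  ... | t' , us₁ with plugB k ts us₁
  ... | ts' , us₂ = (t' ∷ ts') , us₂

inserts : {A : Set} → A → List A → List (List A)
inserts x [] = (x ∷ []) ∷ []
inserts x (y ∷ ys) = (x ∷ y ∷ ys) ∷ map (y ∷_) (inserts x ys)

perms : {A : Set} → List A → List (List A)
perms [] = [] ∷ []
perms (x ∷ xs) = concatMap (inserts x) (perms xs)

rsubst : RTerm → Bag → FSum
rsubst s ts with occ 0 s ≟ length ts
... | yes _ = map (λ us → proj₁ (plug 0 s us)) (perms ts)
... | no _ = []

mutual
  data _↦r_ : RTerm → FSum → Set where
    rβ    : ∀ {s ts} → rapp (rlam s) ts ↦r rsubst s ts
    rlamr : ∀ {s S} → s ↦r S → rlam s ↦r map rlam S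
    rappL : ∀ {s S ts} → s ↦r S → rapp s ts ↦r map (λ u → rapp u ts) S
    rappR : ∀ {s ts TS} → ts ↦ₘ TS → rapp s ts ↦r map (rapp s) TS

  data _↦ₘ_ : Bag → List Bag → Set where
    rbag : ∀ {s S ts₁ ts₂} → s ↦r S →
           (ts₁ ++ s ∷ ts₂) ↦ₘ map (λ u → ts₁ ++ u ∷ ts₂) S

StepOrStay : RTerm → FSum → Set
StepOrStay s T = (s ↦r T) ⊎ (T ≡ s ∷ [])

_→r_ : FSum → FSum → Set
S →r S' = Σ[ s₀ ∈ RTerm ] Σ[ ss ∈ List RTerm ] Σ[ T₀ ∈ FSum ] Σ[ Ts ∈ List FSum ]
  ((S ≋ (s₀ ∷ ss)) × (s₀ ↦r T₀) × Pointwise StepOrStay ss Ts ×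
   (S' ≋ (T₀ ++ concat Ts)))

data _→r*_ : FSum → FSum → Set where
  done : ∀ {S S'} → S ≋ S' → S →r* S'
  step : ∀ {S S' S''} → S →r S' → S' →r* S'' → S →r* S''

data _⋉_ : RTerm → Tree → Set where
  var : ∀ {x M} → M [] ≡ var x → rvar x ⋉ M
  lam : ∀ {s M} → M [] ≡ lam → s ⋉ child body M → rlam s ⋉ M
  app : ∀ {s ts M} → M [] ≡ app → s ⋉ child left M →
        All (_⋉ child right M) ts → rapp s ts ⋉ M

module Submission where

-- A β-step of the tree M acts on each approximant of M as a finite resource
-- reduction (a redex approximant reduces to the sum of its linear
-- substitutions, which approximate the contractum), and conversely every
-- approximant of the reduct is a summand of such a reduction.  For M →β∞ N
-- this is iterated along the derivation: an approximant s of M follows the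
-- finite reduction at the root to a head form and then recursively its
-- λ-body, resp. its function part and each element of its argument bag.
-- Resource reduction never increases size and each descent strictly lowers
-- it, so the process stops with a finite sum of approximants of N.  Dually,
-- an approximant t of N is finite, so it inspects only finitely many nodes
-- of the derivation; by induction on t one finds an approximant of M
-- reducing to a sum that contains t.

open import Defs
open import Data.Bool using (true; false; if_then_else_)
open import Data.Empty using (⊥-elim)
open import Data.List using (List; []; _∷_; _++_; [_]; map; length)
open import Data.List.Properties using (map-++; map-∘; ++-assoc; ++-identityʳ; length-++; concat-map-[_])
open import Data.List.Membership.Propositional using (_∈_; find; lose)
open import Data.List.Membership.Propositional.Properties
  using (∈-map⁺; ∈-map⁻; ∈-∃++; ∈-concatMap⁻; ∈-concatMap⁺)
open import Data.List.Relation.Binary.Pointwise using (Pointwise; []; _∷_)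
open import Data.List.Relation.Binary.Permutation.Propositional
  using (_↭_; prep; swap; ↭-sym; ↭-refl; ↭-trans)
open import Data.List.Relation.Binary.Permutation.Propositional.Properties as ↭
  using (Any-resp-↭; All-resp-↭; ↭-length; shift; shifts)
open import Data.List.Relation.Unary.All as All using (All; []; _∷_)
import Data.List.Relation.Unary.All.Properties as All
open import Data.List.Relation.Unary.Any as Any using (here; there)
import Data.List.Relation.Unary.Any.Properties as Any
open import Data.Nat
  using (ℕ; zero; suc; pred; _+_; _≤_; _<_; s≤s; _≟_; _<ᵇ_; _≡ᵇ_; compare; less; equal; greater)
open import Data.Nat.Properties
  using (≤-refl; ≤-trans; m≤m+n; m≤n+m; n≤1+n; +-monoʳ-≤; +-monoˡ-≤; +-monoˡ-<; +-monoʳ-<;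
         +-assoc; +-comm; +-identityʳ; +-commutativeSemigroup; <-irrefl; <-asym; <⇒≢; >⇒≢; <-cmp;
         module ≤-Reasoning)
open import Data.Nat.ListAction using (sum)
open import Data.Nat.ListAction.Properties using (sum-↭)
open import Algebra.Properties.CommutativeSemigroup +-commutativeSemigroup using (x∙yz≈y∙xz)
open import Data.Product using (Σ-syntax; ∃₂; ∃-syntax; _×_; _,_; proj₁; proj₂)
open import Data.Sum using (inj₁; inj₂)
open import Function using (id; _∘_)
open import Function.Bundles using (_⇔_; mk⇔)
open import Relation.Binary using (tri<; tri≈; tri>)
open import Relation.Binary.Construct.Closure.ReflexiveTransitive using (Star; ε; _◅_; _◅◅_)
open import Relation.Binary.PropositionalEquality
  using (_≡_; _≢_; _≗_; refl; sym; trans; cong; cong₂; subst; subst₂)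
open import Relation.Nullary using (yes; no; ¬_)
open import Relation.Unary using (_⊆_)

-- Approximants

mutual
  ≅-refl : ∀ s → s ≅ s
  ≅-refl (rvar x) = rvar
  ≅-refl (rlam s) = rlam (≅-refl s)
  ≅-refl (rapp s ts) = rapp (≅-refl s) (≅ₘ-refl ts)

  ≅ₘ-refl : ∀ ts → ts ≅ₘ ts
  ≅ₘ-refl [] = []
  ≅ₘ-refl (t ∷ ts) = cons {ts₁ = []} (≅-refl t) (≅ₘ-refl ts)

mutual
  ⋉-respˡ-≅ : ∀ {u v T} → u ≅ v → v ⋉ T → u ⋉ T
  ⋉-respˡ-≅ rvar h = h
  ⋉-respˡ-≅ (rlam e) (lam r h) = lam r (⋉-respˡ-≅ e h)
  ⋉-respˡ-≅ (rapp e es) (app r h hs) = app r (⋉-respˡ-≅ e h) (All⋉-respˡ-≅ₘ es hs)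

  All⋉-respˡ-≅ₘ : ∀ {us vs T} → us ≅ₘ vs → All (_⋉ T) vs → All (_⋉ T) us
  All⋉-respˡ-≅ₘ [] hs = []
  All⋉-respˡ-≅ₘ (cons {ts₁ = ts₁} e es) hs with All.++⁻ ts₁ hs
  ... | hs₁ , h ∷ hs₂ = ⋉-respˡ-≅ e h ∷ All⋉-respˡ-≅ₘ es (All.++⁺ hs₁ hs₂)

≈-sym : ∀ {M M'} → M ≈ M' → M' ≈ M
≈-sym e p = sym (e p)

mutual
  ⋉-respʳ-≈ : ∀ {s M M'} → s ⋉ M → M ≈ M' → s ⋉ M'
  ⋉-respʳ-≈ (var r) e = var (trans (sym (e [])) r)
  ⋉-respʳ-≈ (lam r h) e = lam (trans (sym (e [])) r) (⋉-respʳ-≈ h (e ∘ (body ∷_)))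
  ⋉-respʳ-≈ (app r h hs) e =
    app (trans (sym (e [])) r) (⋉-respʳ-≈ h (e ∘ (left ∷_))) (All⋉-respʳ-≈ hs (e ∘ (right ∷_)))

  All⋉-respʳ-≈ : ∀ {ts M M'} → All (_⋉ M) ts → M ≈ M' → All (_⋉ M') ts
  All⋉-respʳ-≈ [] e = []
  All⋉-respʳ-≈ (h ∷ hs) e = ⋉-respʳ-≈ h e ∷ All⋉-respʳ-≈ hs e

⋉-varT⁻ : ∀ {t y} → t ⋉ varT y → t ≡ rvar y
⋉-varT⁻ (var refl) = refl

⋉-lam⁻ : ∀ {t T} → T [] ≡ lam → t ⋉ T → ∃[ u ] (t ≡ rlam u × u ⋉ child body T)
⋉-lam⁻ e (var e') with () ← trans (sym e) e'
⋉-lam⁻ e (lam _ h) = _ , refl , h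
⋉-lam⁻ e (app e' _ _) with () ← trans (sym e) e'

⋉-app⁻ : ∀ {t T} → T [] ≡ app → t ⋉ T →
         ∃₂ λ u us → t ≡ rapp u us × u ⋉ child left T × All (_⋉ child right T) us
⋉-app⁻ e (var e') with () ← trans (sym e) e'
⋉-app⁻ e (lam e' _) with () ← trans (sym e) e'
⋉-app⁻ e (app _ h hs) = _ , _ , refl , h , hs

⋉-none⁻ : ∀ {t T} → T [] ≡ none → ¬ t ⋉ T
⋉-none⁻ e (var e') with () ← trans (sym e) e'
⋉-none⁻ e (lam e' _) with () ← trans (sym e) e'
⋉-none⁻ e (app e' _ _) with () ← trans (sym e) e'

⋉-varT⇒ : ∀ {T x t} → T [] ≡ var x → t ⋉ varT x → t ⋉ T
⋉-varT⇒ e (var refl) = var e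

⋉-lamT⇒ : ∀ {T B t} → T [] ≡ lam → B ≈ child body T → t ⋉ lamT B → t ⋉ T
⋉-lamT⇒ e B≈ (lam _ h) = lam e (⋉-respʳ-≈ h B≈)

⋉-appT⇒ : ∀ {T A B t} → T [] ≡ app → A ≈ child left T → B ≈ child right T →
          t ⋉ appT A B → t ⋉ T
⋉-appT⇒ e A≈ B≈ (app _ h hs) = app e (⋉-respʳ-≈ h A≈) (All⋉-respʳ-≈ hs B≈)

-- Sums and their reducts

-- Sums are lists read as sets; _⟶_ reduces one summand in place, which
-- composes more easily than _→r_ and implies it.
data _⟶_ : FSum → FSum → Set where
  reduce : ∀ X {u U} Y → u ↦r U → (X ++ u ∷ Y) ⟶ (X ++ U ++ Y)

_⟶*_ : FSum → FSum → Set
_⟶*_ = Star _⟶_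

⟶*-singleton : ∀ {u U} → u ↦r U → (u ∷ []) ⟶* U
⟶*-singleton {u} {U} r = subst ((u ∷ []) ⟶_) (++-identityʳ U) (reduce [] [] r) ◅ ε

⟶*-++ˡ : ∀ L {S S'} → S ⟶* S' → (L ++ S) ⟶* (L ++ S')
⟶*-++ˡ L ε = ε
⟶*-++ˡ L (reduce X {u} {U} Y r ◅ rs) =
  subst₂ _⟶_ (++-assoc L X (u ∷ Y)) (++-assoc L X (U ++ Y)) (reduce (L ++ X) Y r) ◅ ⟶*-++ˡ L rs

⟶*-++ʳ : ∀ L {S S'} → S ⟶* S' → (S ++ L) ⟶* (S' ++ L)
⟶*-++ʳ L ε = ε
⟶*-++ʳ L (reduce X {u} {U} Y r ◅ rs) =
  subst₂ _⟶_ (sym (++-assoc X (u ∷ Y) L))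
    (sym (trans (++-assoc X (U ++ Y) L) (cong (X ++_) (++-assoc U Y L))))
    (reduce X (Y ++ L) r) ◅ ⟶*-++ʳ L rs

⟶*-++ : ∀ {S S' L L'} → S ⟶* S' → L ⟶* L' → (S ++ L) ⟶* (S' ++ L')
⟶*-++ {S' = S'} {L = L} r r' = ⟶*-++ʳ L r ◅◅ ⟶*-++ˡ S' r'

Lifts : (RTerm → RTerm) → Set
Lifts C = ∀ {u U} → u ↦r U → C u ↦r map C U

⟶*-map : ∀ {C} → Lifts C → ∀ {S S'} → S ⟶* S' → map C S ⟶* map C S'
⟶*-map lifts ε = ε
⟶*-map {C} lifts (reduce X {u} {U} Y r ◅ rs) =
  subst₂ _⟶_ (sym (map-++ C X (u ∷ Y)))
    (trans (cong (map C X ++_) (sym (map-++ C U Y))) (sym (map-++ C X (U ++ Y))))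
    (reduce (map C X) (map C Y) (lifts r)) ◅ ⟶*-map lifts rs

↭⇒≋ : ∀ {S S'} → S ↭ S' → S ≋ S'
↭⇒≋ p u = mk⇔ (Any-resp-↭ p) (Any-resp-↭ (↭-sym p))

≋-refl : ∀ {S} → S ≋ S
≋-refl u = mk⇔ id id

⟶⇒→r : ∀ {S S'} → S ⟶ S' → S →r S'
⟶⇒→r (reduce X {u} {U} Y r) =
  u , X ++ Y , U , map [_] (X ++ Y) , ↭⇒≋ (shift u X Y) , r , stays (X ++ Y) ,
  subst (λ Z → (X ++ U ++ Y) ≋ (U ++ Z)) (sym (concat-map-[ X ++ Y ])) (↭⇒≋ (shifts X U))
  where
  stays : ∀ L → Pointwise StepOrStay L (map [_] L)
  stays [] = []
  stays (x ∷ L) = inj₂ refl ∷ stays L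

⟶*⇒→r* : ∀ {S S'} → S ⟶* S' → S →r* S'
⟶*⇒→r* ε = done ≋-refl
⟶*⇒→r* (r ◅ rs) = step (⟶⇒→r r) (⟶*⇒→r* rs)

Reducts : (RTerm → Set) → FSum → Set
Reducts Q S = Σ[ S' ∈ FSum ] (S ⟶* S' × All Q S')

Reduct : (RTerm → Set) → RTerm → Set
Reduct Q s = Reducts Q (s ∷ [])

Reduct∋ : (RTerm → Set) → RTerm → RTerm → Set
Reduct∋ Q s t = Σ[ S ∈ FSum ] ((s ∷ []) ⟶* S × t ∈ S × All Q S)

Image : (RTerm → RTerm) → (RTerm → Set) → RTerm → Set
Image C Q t = Σ[ v ∈ RTerm ] (t ≡ C v × Q v)

module _ {Q : RTerm → Set} where

  reduct-refl : ∀ {s} → Q s → Reduct Q s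
  reduct-refl q = _ , ε , q ∷ []

  reduct∋-refl : ∀ {s} → Q s → Reduct∋ Q s s
  reduct∋-refl q = _ , ε , here refl , q ∷ []

  reduct∋⇒reduct : ∀ {s t} → Reduct∋ Q s t → Reduct Q s
  reduct∋⇒reduct (S , r , _ , q) = S , r , q

  reduct∋-target : ∀ {s t} → Reduct∋ Q s t → Q t
  reduct∋-target (_ , _ , t∈S , q) = All.lookup q t∈S

  reduct-map : ∀ {P} → P ⊆ Q → ∀ {s} → Reduct P s → Reduct Q s
  reduct-map f (S , r , p) = S , r , All.map f p

  reduct∋-map : ∀ {P} → P ⊆ Q → ∀ {s t} → Reduct∋ P s t → Reduct∋ Q s t
  reduct∋-map f (S , r , t∈S , p) = S , r , t∈S , All.map f p

  reducts-All : ∀ {S} → All (Reduct Q) S → Reducts Q S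
  reducts-All [] = [] , ε , []
  reducts-All ((S₁ , r₁ , q₁) ∷ rs) with reducts-All rs
  ... | S₂ , r₂ , q₂ = S₁ ++ S₂ , ⟶*-++ r₁ r₂ , All.++⁺ q₁ q₂

  reduct-trans : ∀ {P} → P ⊆ Reduct Q → ∀ {s} → Reduct P s → Reduct Q s
  reduct-trans f (S , r , p) with reducts-All (All.map f p)
  ... | S' , r' , q = S' , r ◅◅ r' , q

  reduct∋-trans : ∀ {P} → P ⊆ Reduct Q →
                  ∀ {s m t} → Reduct∋ P s m → Reduct∋ Q m t → Reduct∋ Q s t
  reduct∋-trans f (S , r , m∈S , p) (T , rₘ , t∈T , qₘ) with ∈-∃++ m∈S
  ... | X , Y , refl with All.++⁻ X p
  ... | pX , _ ∷ pY with reducts-All (All.map f pX) | reducts-All (All.map f pY)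
  ... | X' , rX , qX | Y' , rY , qY =
    X' ++ T ++ Y' , r ◅◅ ⟶*-++ rX (⟶*-++ rₘ rY) ,
    Any.++⁺ʳ X' (Any.++⁺ˡ t∈T) , All.++⁺ qX (All.++⁺ qₘ qY)

  reduct-context : ∀ C → Lifts C → ∀ {s} → Reduct Q s → Reduct (Image C Q) (C s)
  reduct-context C lifts (S , r , q) =
    map C S , ⟶*-map lifts r , All.map⁺ (All.map (λ {v} qv → v , refl , qv) q)

  reduct∋-context : ∀ C → Lifts C → ∀ {s t} → Reduct∋ Q s t → Reduct∋ (Image C Q) (C s) (C t)
  reduct∋-context C lifts (S , r , t∈S , q) =
    map C S , ⟶*-map lifts r , ∈-map⁺ C t∈S , All.map⁺ (All.map (λ {v} qv → v , refl , qv) q)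

BagContext : (Bag → RTerm) → Set
BagContext D = ∀ ts₁ ts₂ → Lifts (λ v → D (ts₁ ++ v ∷ ts₂))

rapp-bagContext : ∀ s → BagContext (rapp s)
rapp-bagContext s ts₁ ts₂ {U = U} r =
  subst (rapp s (ts₁ ++ _ ∷ ts₂) ↦r_) (sym (map-∘ U)) (rappR (rbag r))

Filled : (Bag → RTerm) → (RTerm → Set) → RTerm → Set
Filled D Q t = Σ[ bs ∈ Bag ] (t ≡ D bs × All Q bs)

module _ {Q : RTerm → Set} where

  filled-cons : ∀ {D v} → Q v → Filled (D ∘ (v ∷_)) Q ⊆ Filled D Q
  filled-cons qv (bs , refl , qbs) = _ ∷ bs , refl , qv ∷ qbs

  reduct∋-sources : ∀ {bs cs} → Pointwise (Reduct∋ Q) bs cs → All (Reduct Q) bs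
  reduct∋-sources [] = []
  reduct∋-sources (r ∷ rs) = reduct∋⇒reduct r ∷ reduct∋-sources rs

  reduct-bag : ∀ {D} → BagContext D → ∀ {bs} → All (Reduct Q) bs → Reduct (Filled D Q) (D bs)
  reduct-bag bc [] = reduct-refl ([] , refl , [])
  reduct-bag {D} bc (r ∷ rs) =
    reduct-trans (λ { (v , refl , qv) → reduct-map (filled-cons qv) (reduct-bag (bc ∘ (v ∷_)) rs) })
      (reduct-context (λ v → D (v ∷ _)) (bc [] _) r)

  reduct∋-bag : ∀ {D} → BagContext D → ∀ {bs cs} → Pointwise (Reduct∋ Q) bs cs →
                Reduct∋ (Filled D Q) (D bs) (D cs)
  reduct∋-bag bc [] = reduct∋-refl ([] , refl , [])
  reduct∋-bag {D} bc (r ∷ rs) =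
    reduct∋-trans (λ { (v , refl , qv) →
                       reduct-map (filled-cons qv) (reduct-bag (bc ∘ (v ∷_)) (reduct∋-sources rs)) })
      (reduct∋-context (λ v → D (v ∷ _)) (bc [] _) r)
      (reduct∋-map (filled-cons (reduct∋-target r)) (reduct∋-bag (bc ∘ (_ ∷_)) rs))

reduct-lam : ∀ {B s} → Reduct (_⋉ B) s → Reduct (_⋉ lamT B) (rlam s)
reduct-lam r = reduct-map (λ { (_ , refl , h) → lam refl h }) (reduct-context rlam rlamr r)

reduct∋-lam : ∀ {B s t} → Reduct∋ (_⋉ B) s t → Reduct∋ (_⋉ lamT B) (rlam s) (rlam t)
reduct∋-lam r = reduct∋-map (λ { (_ , refl , h) → lam refl h }) (reduct∋-context rlam rlamr r)

reduct-app : ∀ {A B a bs} → Reduct (_⋉ A) a → All (Reduct (_⋉ B)) bs → Reduct (_⋉ appT A B) (rapp a bs)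
reduct-app ra rs =
  reduct-trans (λ { (u , refl , hu) → reduct-map (λ { (_ , refl , hbs) → app refl hu hbs })
                                                   (reduct-bag (rapp-bagContext u) rs) })
    (reduct-context (λ u → rapp u _) rappL ra)

reduct∋-app : ∀ {A B a c bs cs} → Reduct∋ (_⋉ A) a c → Pointwise (Reduct∋ (_⋉ B)) bs cs →
              Reduct∋ (_⋉ appT A B) (rapp a bs) (rapp c cs)
reduct∋-app ra rs =
  reduct∋-trans (λ { (u , refl , hu) → reduct-map (λ { (_ , refl , hbs) → app refl hu hbs })
                                                    (reduct-bag (rapp-bagContext u) (reduct∋-sources rs)) })
    (reduct∋-context (λ u → rapp u _) rappL ra)
    (reduct∋-map (λ { (_ , refl , hbs) → app refl (reduct∋-target ra) hbs })
                 (reduct∋-bag (rapp-bagContext _) rs))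

-- Permutations and size

module _ {A : Set} where

  inserts-↭ : ∀ (x : A) ys {l} → l ∈ inserts x ys → l ↭ x ∷ ys
  inserts-↭ x [] (here refl) = ↭-refl
  inserts-↭ x (y ∷ ys) (here refl) = ↭-refl
  inserts-↭ x (y ∷ ys) (there l∈) with ∈-map⁻ (y ∷_) l∈
  ... | l' , l'∈ , refl = ↭-trans (prep y (inserts-↭ x ys l'∈)) (swap y x ↭-refl)

  perms-↭ : ∀ (xs : List A) {σ} → σ ∈ perms xs → σ ↭ xs
  perms-↭ [] (here refl) = ↭-refl
  perms-↭ (x ∷ xs) σ∈ with find (∈-concatMap⁻ (inserts x) {xs = perms xs} σ∈)
  ... | τ , τ∈ , σ∈' = ↭-trans (inserts-↭ x τ σ∈') (prep x (perms-↭ xs τ∈))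

  inserts-head : ∀ (x : A) ys → x ∷ ys ∈ inserts x ys
  inserts-head x [] = here refl
  inserts-head x (y ∷ ys) = here refl

  self∈perms : ∀ (xs : List A) → xs ∈ perms xs
  self∈perms [] = here refl
  self∈perms (x ∷ xs) = ∈-concatMap⁺ (inserts x) (lose (self∈perms xs) (inserts-head x xs))

mutual
  size : RTerm → ℕ
  size (rvar x) = 1
  size (rlam s) = suc (size s)
  size (rapp s ts) = suc (size s + sizeB ts)

  sizeB : Bag → ℕ
  sizeB [] = 0
  sizeB (t ∷ ts) = size t + sizeB ts

sizeB≡sum : ∀ ts → sizeB ts ≡ sum (map size ts)
sizeB≡sum [] = refl
sizeB≡sum (t ∷ ts) = cong (size t +_) (sizeB≡sum ts)

sizeB-↭ : ∀ {ts us} → ts ↭ us → sizeB ts ≡ sizeB us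
sizeB-↭ {ts} {us} p = trans (sizeB≡sum ts) (trans (sum-↭ (↭.map⁺ size p)) (sym (sizeB≡sum us)))

size≤sizeB : ∀ ts → All (λ t → size t ≤ sizeB ts) ts
size≤sizeB [] = []
size≤sizeB (t ∷ ts) =
  m≤m+n (size t) (sizeB ts) ∷ All.map (λ h → ≤-trans h (m≤n+m _ (size t))) (size≤sizeB ts)

mutual
  size-rren : ∀ ρ u → size (rren ρ u) ≡ size u
  size-rren ρ (rvar x) = refl
  size-rren ρ (rlam u) = cong suc (size-rren (ext ρ) u)
  size-rren ρ (rapp u us) = cong suc (cong₂ _+_ (size-rren ρ u) (sizeB-rrenB ρ us))

  sizeB-rrenB : ∀ ρ us → sizeB (rrenB ρ us) ≡ sizeB us
  sizeB-rrenB ρ [] = refl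
  sizeB-rrenB ρ (u ∷ us) = cong₂ _+_ (size-rren ρ u) (sizeB-rrenB ρ us)

+-≤-accumulate : ∀ a a' b b' {u u₁ u₂} → a' + u₁ ≤ a + u → b' + u₂ ≤ b + u₁ →
                 (a' + b') + u₂ ≤ (a + b) + u
+-≤-accumulate a a' b b' {u} {u₁} {u₂} h₁ h₂ = begin
  (a' + b') + u₂  ≡⟨ +-assoc a' b' u₂ ⟩
  a' + (b' + u₂)  ≤⟨ +-monoʳ-≤ a' h₂ ⟩
  a' + (b + u₁)   ≡⟨ x∙yz≈y∙xz a' b u₁ ⟩
  b + (a' + u₁)   ≤⟨ +-monoʳ-≤ b h₁ ⟩
  b + (a + u)     ≡⟨ x∙yz≈y∙xz b a u ⟩
  a + (b + u)     ≡⟨ +-assoc a b u ⟨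
  (a + b) + u     ∎
  where open ≤-Reasoning

mutual
  plug-size : ∀ k s us → size (proj₁ (plug k s us)) + sizeB (proj₂ (plug k s us)) ≤ size s + sizeB us
  plug-size k (rvar x) us with compare x k
  plug-size k (rvar x) us | less _ _ = ≤-refl
  plug-size k (rvar .k) [] | equal _ = ≤-refl
  plug-size k (rvar .k) (u ∷ us) | equal _ rewrite size-rren (k +_) u = n≤1+n _
  plug-size k (rvar x) us | greater _ _ = ≤-refl
  plug-size k (rlam s) us with plug (suc k) s us | plug-size (suc k) s us
  ... | _ | h = s≤s h
  plug-size k (rapp s ts) us with plug k s us | plug-size k s us
  ... | s' , us₁ | h₁ with plugB k ts us₁ | plugB-size k ts us₁
  ... | ts' , _ | h₂ = s≤s (+-≤-accumulate (size s) (size s') (sizeB ts) (sizeB ts') h₁ h₂)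

  plugB-size : ∀ k ts us →
               sizeB (proj₁ (plugB k ts us)) + sizeB (proj₂ (plugB k ts us)) ≤ sizeB ts + sizeB us
  plugB-size k [] us = ≤-refl
  plugB-size k (t ∷ ts) us with plug k t us | plug-size k t us
  ... | t' , us₁ | h₁ with plugB k ts us₁ | plugB-size k ts us₁
  ... | ts' , _ | h₂ = +-≤-accumulate (size t) (size t') (sizeB ts) (sizeB ts') h₁ h₂

size-rsubst : ∀ s ts → All (λ v → size v < size (rapp (rlam s) ts)) (rsubst s ts)
size-rsubst s ts with occ 0 s ≟ length ts
... | no _ = []
... | yes _ = All.map⁺ (All.tabulate λ {σ} σ∈ → s≤s (begin
  size (proj₁ (plug 0 s σ))  ≤⟨ m≤m+n _ _ ⟩
  _                          ≤⟨ plug-size 0 s σ ⟩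
  size s + sizeB σ           ≡⟨ cong (size s +_) (sizeB-↭ (perms-↭ ts σ∈)) ⟩
  size s + sizeB ts          ≤⟨ n≤1+n _ ⟩
  suc (size s + sizeB ts)    ∎))
  where open ≤-Reasoning

sizeB-< : ∀ ts₁ ts₂ {u v} → size v < size u → sizeB (ts₁ ++ v ∷ ts₂) < sizeB (ts₁ ++ u ∷ ts₂)
sizeB-< [] ts₂ h = +-monoˡ-< (sizeB ts₂) h
sizeB-< (t ∷ ts₁) ts₂ h = +-monoʳ-< (size t) (sizeB-< ts₁ ts₂ h)

mutual
  ↦r-size : ∀ {u U} → u ↦r U → All (λ v → size v < size u) U
  ↦r-size (rβ {s} {ts}) = size-rsubst s ts
  ↦r-size (rlamr r) = All.map⁺ (All.map s≤s (↦r-size r))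
  ↦r-size (rappL {ts = ts} r) = All.map⁺ (All.map (λ h → s≤s (+-monoˡ-≤ (sizeB ts) h)) (↦r-size r))
  ↦r-size (rappR {s = s} r) = All.map⁺ (All.map (λ h → s≤s (+-monoʳ-< (size s) h)) (↦ₘ-size r))

  ↦ₘ-size : ∀ {ts TS} → ts ↦ₘ TS → All (λ vs → sizeB vs < sizeB ts) TS
  ↦ₘ-size (rbag {ts₁ = ts₁} {ts₂} r) = All.map⁺ (All.map (sizeB-< ts₁ ts₂) (↦r-size r))

⟶*-size : ∀ {n S S'} → S ⟶* S' → All (λ t → size t ≤ n) S → All (λ t → size t ≤ n) S'
⟶*-size ε h = h
⟶*-size (reduce X Y r ◅ rs) h with All.++⁻ X h
... | hX , hu ∷ hY =
  ⟶*-size rs (All.++⁺ hX (All.++⁺ (All.map (λ lt → ≤-trans (n≤1+n _) (≤-trans lt hu)) (↦r-size r)) hY))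

reduct-size : ∀ {Q s} → Reduct Q s → Reduct (λ t → Q t × size t ≤ size s) s
reduct-size (S , r , q) = S , r , All.zip (q , ⟶*-size r (≤-refl ∷ []))

-- Shifting and substitution

relabel : (ℕ → ℕ) → Label → Label
relabel f (var y) = var (f y)
relabel f lam = lam
relabel f app = app
relabel f none = none

relabel-var⁻ : ∀ {f l x} → relabel f l ≡ var x → ∃[ y ] (l ≡ var y × f y ≡ x)
relabel-var⁻ {l = var y} refl = y , refl , refl

relabel-lam⁻ : ∀ {f l} → relabel f l ≡ lam → l ≡ lam
relabel-lam⁻ {l = lam} refl = refl

relabel-app⁻ : ∀ {f l} → relabel f l ≡ app → l ≡ app
relabel-app⁻ {l = app} refl = refl

sh : ℕ → ℕ → ℕ → ℕ
sh k j y = if y <ᵇ j then y else y + k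

shiftAt-root : ∀ k j N → shiftAt k j N [] ≡ relabel (sh k j) (N [])
shiftAt-root k j N with N []
... | var y with y <ᵇ j
...   | true = refl
...   | false = refl
shiftAt-root k j N | lam = refl
shiftAt-root k j N | app = refl
shiftAt-root k j N | none = refl

shiftAt-root-≡ : ∀ k j N {l} → N [] ≡ l → shiftAt k j N [] ≡ relabel (sh k j) l
shiftAt-root-≡ k j N e = trans (shiftAt-root k j N) (cong (relabel (sh k j)) e)

ext-sh : ∀ k j {ρ} → ρ ≗ sh k j → ext ρ ≗ sh k (j + 1)
ext-sh k j h zero rewrite +-comm j 1 = refl
ext-sh k j h (suc y) rewrite +-comm j 1 | h y with y <ᵇ j
... | true = refl
... | false = refl

sh-+0 : ∀ k j {ρ} → ρ ≗ sh k j → ρ ≗ sh k (j + 0)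
sh-+0 k j h rewrite +-identityʳ j = h

mutual
  ⋉-shift⁺ : ∀ k j {ρ u N} → ρ ≗ sh k j → u ⋉ N → rren ρ u ⋉ shiftAt k j N
  ⋉-shift⁺ k j {N = N} h (var e) = var (trans (shiftAt-root-≡ k j N e) (cong var (sym (h _))))
  ⋉-shift⁺ k j {N = N} h (lam e d) = lam (shiftAt-root-≡ k j N e) (⋉-shift⁺ k (j + 1) (ext-sh k j h) d)
  ⋉-shift⁺ k j {N = N} h (app e d ds) =
    app (shiftAt-root-≡ k j N e) (⋉-shift⁺ k (j + 0) (sh-+0 k j h) d)
        (All⋉-shift⁺ k (j + 0) (sh-+0 k j h) ds)

  All⋉-shift⁺ : ∀ k j {ρ us N} → ρ ≗ sh k j → All (_⋉ N) us → All (_⋉ shiftAt k j N) (rrenB ρ us)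
  All⋉-shift⁺ k j h [] = []
  All⋉-shift⁺ k j h (d ∷ ds) = ⋉-shift⁺ k j h d ∷ All⋉-shift⁺ k j h ds

mutual
  ⋉-shift⁻ : ∀ k j {ρ t N} → ρ ≗ sh k j → t ⋉ shiftAt k j N → ∃[ u ] (u ⋉ N × rren ρ u ≡ t)
  ⋉-shift⁻ k j {N = N} h (var e) with relabel-var⁻ (trans (sym (shiftAt-root k j N)) e)
  ... | y , eN , refl = rvar y , var eN , cong rvar (h y)
  ⋉-shift⁻ k j {N = N} h (lam e d) with ⋉-shift⁻ k (j + 1) (ext-sh k j h) d
  ... | u , du , refl = rlam u , lam (relabel-lam⁻ (trans (sym (shiftAt-root k j N)) e)) du , refl
  ⋉-shift⁻ k j {N = N} h (app e d ds)
    with ⋉-shift⁻ k (j + 0) (sh-+0 k j h) d | All⋉-shift⁻ k (j + 0) (sh-+0 k j h) ds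
  ... | u , du , refl | us , dus , refl =
    rapp u us , app (relabel-app⁻ (trans (sym (shiftAt-root k j N)) e)) du dus , refl

  All⋉-shift⁻ : ∀ k j {ρ ts N} → ρ ≗ sh k j → All (_⋉ shiftAt k j N) ts →
                ∃[ us ] (All (_⋉ N) us × rrenB ρ us ≡ ts)
  All⋉-shift⁻ k j h [] = [] , [] , refl
  All⋉-shift⁻ k j h (d ∷ ds) with ⋉-shift⁻ k j h d | All⋉-shift⁻ k j h ds
  ... | u , du , refl | us , dus , refl = u ∷ us , du ∷ dus , refl

<-suc-+ : ∀ m n → m < suc (m + n)
<-suc-+ m n = s≤s (m≤m+n m n)

≡ᵇ-refl : ∀ n → (n ≡ᵇ n) ≡ true
≡ᵇ-refl zero = refl
≡ᵇ-refl (suc n) = ≡ᵇ-refl n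

≢⇒≡ᵇ-false : ∀ {m n} → m ≢ n → (m ≡ᵇ n) ≡ false
≢⇒≡ᵇ-false {zero} {zero} m≢n = ⊥-elim (m≢n refl)
≢⇒≡ᵇ-false {zero} {suc n} m≢n = refl
≢⇒≡ᵇ-false {suc m} {zero} m≢n = refl
≢⇒≡ᵇ-false {suc m} {suc n} m≢n = ≢⇒≡ᵇ-false (m≢n ∘ cong suc)

module _ (k : ℕ) (M N : Tree) where

  subAt-var< : ∀ {y} → M [] ≡ var y → y < k → subAt k M N ≈ varT y
  subAt-var< {y} e y<k [] rewrite e with compare y k
  ... | less _ _ = refl
  ... | equal _ = ⊥-elim (<-irrefl refl y<k)
  ... | greater _ m = ⊥-elim (<-asym y<k (<-suc-+ k m))
  subAt-var< e y<k (d ∷ p) rewrite e | ≢⇒≡ᵇ-false (<⇒≢ y<k) = refl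

  subAt-var> : ∀ {y} → M [] ≡ var y → k < y → subAt k M N ≈ varT (pred y)
  subAt-var> {y} e k<y [] rewrite e with compare y k
  ... | less _ m = ⊥-elim (<-asym k<y (<-suc-+ y m))
  ... | equal _ = ⊥-elim (<-irrefl refl k<y)
  ... | greater _ _ = refl
  subAt-var> e k<y (d ∷ p) rewrite e | ≢⇒≡ᵇ-false (>⇒≢ k<y) = refl

  subAt-var≡ : ∀ {y} → M [] ≡ var y → y ≡ k → subAt k M N ≈ shiftAt k 0 N
  subAt-var≡ {y} e y≡k [] rewrite e with compare y k
  ... | less _ m = ⊥-elim (<-irrefl y≡k (<-suc-+ y m))
  ... | equal _ = refl
  ... | greater _ m = ⊥-elim (<-irrefl (sym y≡k) (<-suc-+ k m))
  subAt-var≡ e refl (d ∷ p) rewrite e | ≡ᵇ-refl k = refl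

  subAt-root-lam : M [] ≡ lam → subAt k M N [] ≡ lam
  subAt-root-lam e rewrite e = refl

  subAt-root-app : M [] ≡ app → subAt k M N [] ≡ app
  subAt-root-app e rewrite e = refl

  subAt-root-none : M [] ≡ none → subAt k M N [] ≡ none
  subAt-root-none e rewrite e = refl

  subAt-body : M [] ≡ lam → child body (subAt k M N) ≈ subAt (suc k) (child body M) N
  subAt-body e p rewrite e | +-comm k 1 = refl

  subAt-left : M [] ≡ app → child left (subAt k M N) ≈ subAt k (child left M) N
  subAt-left e p rewrite e | +-identityʳ k = refl

  subAt-right : M [] ≡ app → child right (subAt k M N) ≈ subAt k (child right M) N
  subAt-right e p rewrite e | +-identityʳ k = refl

occ-≢ : ∀ {y k} → y ≢ k → occ k (rvar y) ≡ 0
occ-≢ {y} {k} y≢k with y ≟ k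
... | yes y≡k = ⊥-elim (y≢k y≡k)
... | no _ = refl

occ-≡ : ∀ k → occ k (rvar k) ≡ 1
occ-≡ k with k ≟ k
... | yes _ = refl
... | no k≢k = ⊥-elim (k≢k refl)

plug-var< : ∀ {y k} us → y < k → plug k (rvar y) us ≡ (rvar y , us)
plug-var< {y} {k} us y<k with compare y k
... | less _ _ = refl
... | equal _ = ⊥-elim (<-irrefl refl y<k)
... | greater _ m = ⊥-elim (<-asym y<k (<-suc-+ k m))

plug-var> : ∀ {y k} us → k < y → plug k (rvar y) us ≡ (rvar (pred y) , us)
plug-var> {y} {k} us k<y with compare y k
... | less _ m = ⊥-elim (<-asym k<y (<-suc-+ y m))
... | equal _ = ⊥-elim (<-irrefl refl k<y)
... | greater _ _ = refl

plug-var≡ : ∀ {y k} u us → y ≡ k → plug k (rvar y) (u ∷ us) ≡ (rren (k +_) u , us)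
plug-var≡ {y} {k} u us y≡k with compare y k
... | less _ m = ⊥-elim (<-irrefl y≡k (<-suc-+ y m))
... | equal _ = refl
... | greater _ m = ⊥-elim (<-irrefl (sym y≡k) (<-suc-+ k m))

plug-lam : ∀ {k a us t rest} → plug (suc k) a us ≡ (t , rest) → plug k (rlam a) us ≡ (rlam t , rest)
plug-lam eq rewrite eq = refl

plug-app : ∀ {k a as us t us₁ ts rest} → plug k a us ≡ (t , us₁) → plugB k as us₁ ≡ (ts , rest) →
           plug k (rapp a as) us ≡ (rapp t ts , rest)
plug-app eq₁ eq₂ rewrite eq₁ | eq₂ = refl

plugB-cons : ∀ {k a as us t us₁ ts rest} → plug k a us ≡ (t , us₁) → plugB k as us₁ ≡ (ts , rest) →
             plugB k (a ∷ as) us ≡ (t ∷ ts , rest)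
plugB-cons eq₁ eq₂ rewrite eq₁ | eq₂ = refl

split-length : ∀ {A : Set} m n (xs : List A) → length xs ≡ m + n →
               ∃₂ λ xs₁ xs₂ → xs ≡ xs₁ ++ xs₂ × length xs₁ ≡ m × length xs₂ ≡ n
split-length zero n xs len = [] , xs , refl , refl , len
split-length (suc m) n (x ∷ xs) len with split-length m n xs (cong pred len)
... | xs₁ , xs₂ , refl , len₁ , len₂ = x ∷ xs₁ , xs₂ , refl , cong suc len₁ , len₂

-- Quantifying over the unused tail of resources makes plugging compose
-- along the arguments of an application.
PlugsTo : ℕ → RTerm → Bag → RTerm → Set
PlugsTo k a us t = ∀ rest → plug k a (us ++ rest) ≡ (t , rest)

PlugsToB : ℕ → Bag → Bag → Bag → Set
PlugsToB k as us ts = ∀ rest → plugB k as (us ++ rest) ≡ (ts , rest)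

plugsTo-app : ∀ {k a as us₁ us₂ t ts} → PlugsTo k a us₁ t → PlugsToB k as us₂ ts →
              PlugsTo k (rapp a as) (us₁ ++ us₂) (rapp t ts)
plugsTo-app {k} {a} {as} {us₁} {us₂} pl₁ pl₂ rest rewrite ++-assoc us₁ us₂ rest =
  plug-app {k} {a} {as} (pl₁ (us₂ ++ rest)) (pl₂ rest)

plugsToB-cons : ∀ {k a as us₁ us₂ t ts} → PlugsTo k a us₁ t → PlugsToB k as us₂ ts →
                PlugsToB k (a ∷ as) (us₁ ++ us₂) (t ∷ ts)
plugsToB-cons {k} {a} {as} {us₁} {us₂} pl₁ pl₂ rest rewrite ++-assoc us₁ us₂ rest =
  plugB-cons {k} {a} {as} (pl₁ (us₂ ++ rest)) (pl₂ rest)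

plug-⋉-var : ∀ {k M N y us} → M [] ≡ var y → All (_⋉ N) us → length us ≡ occ k (rvar y) →
             ∃[ t ] (t ⋉ subAt k M N × PlugsTo k (rvar y) us t)
plug-⋉-var {k} {M} {N} {y} e hus len with <-cmp y k
plug-⋉-var {k} {M} {N} e [] len | tri< y<k _ _ =
  _ , ⋉-respʳ-≈ (var refl) (≈-sym (subAt-var< k M N e y<k)) , λ rest → plug-var< rest y<k
plug-⋉-var e (_ ∷ _) len | tri< y<k _ _ with () ← trans len (occ-≢ (<⇒≢ y<k))
plug-⋉-var {k} e [] len | tri≈ _ refl _ with () ← trans len (occ-≡ k)
plug-⋉-var {k} {M} {N} e (hu ∷ []) len | tri≈ _ refl _ =
  _ , ⋉-respʳ-≈ (⋉-shift⁺ k 0 (+-comm k) hu) (≈-sym (subAt-var≡ k M N e refl)) ,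
  λ rest → plug-var≡ _ rest refl
plug-⋉-var {k} e (_ ∷ _ ∷ _) len | tri≈ _ refl _ with () ← trans len (occ-≡ k)
plug-⋉-var {k} {M} {N} e [] len | tri> _ _ k<y =
  _ , ⋉-respʳ-≈ (var refl) (≈-sym (subAt-var> k M N e k<y)) , λ rest → plug-var> rest k<y
plug-⋉-var e (_ ∷ _) len | tri> _ _ k<y with () ← trans len (occ-≢ (>⇒≢ k<y))

mutual
  plug-⋉ : ∀ {k M N a us} → a ⋉ M → All (_⋉ N) us → length us ≡ occ k a →
           ∃[ t ] (t ⋉ subAt k M N × PlugsTo k a us t)
  plug-⋉ (var e) hus len = plug-⋉-var e hus len
  plug-⋉ {k} {M} {N} {rlam a} (lam e h) hus len with plug-⋉ {suc k} h hus len
  ... | t , ht , pl =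
    rlam t , lam (subAt-root-lam k M N e) (⋉-respʳ-≈ ht (≈-sym (subAt-body k M N e))) ,
    plug-lam {k} {a} ∘ pl
  plug-⋉ {k} {M} {N} {rapp a as} {us} (app e h hs) hus len with split-length (occ k a) (occB k as) us len
  ... | us₁ , us₂ , refl , len₁ , len₂ with All.++⁻ us₁ hus
  ... | hus₁ , hus₂ with plug-⋉ h hus₁ len₁ | plugB-⋉ hs hus₂ len₂
  ... | t , ht , pl₁ | ts , hts , pl₂ =
    rapp t ts ,
    app (subAt-root-app k M N e) (⋉-respʳ-≈ ht (≈-sym (subAt-left k M N e)))
        (All⋉-respʳ-≈ hts (≈-sym (subAt-right k M N e))) ,
    plugsTo-app {k} {a} {as} {us₁} pl₁ pl₂

  plugB-⋉ : ∀ {k M N as us} → All (_⋉ M) as → All (_⋉ N) us → length us ≡ occB k as →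
            ∃[ ts ] (All (_⋉ subAt k M N) ts × PlugsToB k as us ts)
  plugB-⋉ [] [] len = [] , [] , λ rest → refl
  plugB-⋉ {k} {as = a ∷ as} {us} (h ∷ hs) hus len with split-length (occ k a) (occB k as) us len
  ... | us₁ , us₂ , refl , len₁ , len₂ with All.++⁻ us₁ hus
  ... | hus₁ , hus₂ with plug-⋉ h hus₁ len₁ | plugB-⋉ hs hus₂ len₂
  ... | t , ht , pl₁ | ts , hts , pl₂ = t ∷ ts , ht ∷ hts , plugsToB-cons {k} {a} {as} {us₁} pl₁ pl₂

Plugged : ℕ → Tree → Tree → RTerm → Set
Plugged k M N t = Σ[ a ∈ RTerm ] Σ[ us ∈ Bag ]
  (a ⋉ M × All (_⋉ N) us × length us ≡ occ k a × PlugsTo k a us t)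

PluggedB : ℕ → Tree → Tree → Bag → Set
PluggedB k M N ts = Σ[ as ∈ Bag ] Σ[ us ∈ Bag ]
  (All (_⋉ M) as × All (_⋉ N) us × length us ≡ occB k as × PlugsToB k as us ts)

⋉-subAt-var⁻ : ∀ {k M N y t} → M [] ≡ var y → t ⋉ subAt k M N → Plugged k M N t
⋉-subAt-var⁻ {k} {M} {N} {y} e h with <-cmp y k
... | tri< y<k _ _ with ⋉-varT⁻ (⋉-respʳ-≈ h (subAt-var< k M N e y<k))
...   | refl = rvar y , [] , var e , [] , sym (occ-≢ (<⇒≢ y<k)) , λ rest → plug-var< rest y<k
⋉-subAt-var⁻ {k} {M} {N} {y} e h | tri≈ _ refl _
  with ⋉-shift⁻ k 0 (+-comm k) (⋉-respʳ-≈ h (subAt-var≡ k M N e refl))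
... | u , hu , refl = rvar y , u ∷ [] , var e , hu ∷ [] , sym (occ-≡ k) , λ rest → plug-var≡ u rest refl
⋉-subAt-var⁻ {k} {M} {N} {y} e h | tri> _ _ k<y with ⋉-varT⁻ (⋉-respʳ-≈ h (subAt-var> k M N e k<y))
...   | refl = rvar y , [] , var e , [] , sym (occ-≢ (>⇒≢ k<y)) , λ rest → plug-var> rest k<y

mutual
  ⋉-subAt⁻ : ∀ {k M N t} → t ⋉ subAt k M N → Plugged k M N t
  ⋉-subAt⁻ {k} {M} {N} h with M [] in e
  ... | var y = ⋉-subAt-var⁻ e h
  ... | none = ⊥-elim (⋉-none⁻ (subAt-root-none k M N e) h)
  ... | lam with ⋉-lam⁻ (subAt-root-lam k M N e) h
  ...   | t , refl , h' with ⋉-subAt⁻ (⋉-respʳ-≈ h' (subAt-body k M N e))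
  ...     | a , us , ha , hus , len , pl = rlam a , us , lam e ha , hus , len , plug-lam {k} {a} ∘ pl
  ⋉-subAt⁻ {k} {M} {N} h | app with ⋉-app⁻ (subAt-root-app k M N e) h
  ... | t , ts , refl , h₁ , hs with ⋉-subAt⁻ (⋉-respʳ-≈ h₁ (subAt-left k M N e))
                                     | All⋉-subAt⁻ (All⋉-respʳ-≈ hs (subAt-right k M N e))
  ... | a , us₁ , ha , hus₁ , len₁ , pl₁ | as , us₂ , has , hus₂ , len₂ , pl₂ =
    rapp a as , us₁ ++ us₂ , app e ha has , All.++⁺ hus₁ hus₂ ,
    trans (length-++ us₁) (cong₂ _+_ len₁ len₂) , plugsTo-app {k} {a} {as} {us₁} pl₁ pl₂

  All⋉-subAt⁻ : ∀ {k M N ts} → All (_⋉ subAt k M N) ts → PluggedB k M N ts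
  All⋉-subAt⁻ [] = [] , [] , [] , [] , refl , λ rest → refl
  All⋉-subAt⁻ {k} (h ∷ hs) with ⋉-subAt⁻ h | All⋉-subAt⁻ hs
  ... | a , us₁ , ha , hus₁ , len₁ , pl₁ | as , us₂ , has , hus₂ , len₂ , pl₂ =
    a ∷ as , us₁ ++ us₂ , ha ∷ has , All.++⁺ hus₁ hus₂ ,
    trans (length-++ us₁) (cong₂ _+_ len₁ len₂) , plugsToB-cons {k} {a} {as} {us₁} pl₁ pl₂

plugsTo⇒plug : ∀ {k a us t} → PlugsTo k a us t → proj₁ (plug k a us) ≡ t
plugsTo⇒plug {k} {a} {us} pl = cong proj₁ (subst (λ vs → plug k a vs ≡ _) (++-identityʳ us) (pl []))

rsubst-⋉ : ∀ {a M N bs} → a ⋉ M → All (_⋉ N) bs → All (_⋉ (M [ N /0])) (rsubst a bs)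
rsubst-⋉ {a} {bs = bs} ha hbs with occ 0 a ≟ length bs
... | no _ = []
... | yes occ≡len = All.map⁺ (All.tabulate λ {σ} σ∈ → permuted (perms-↭ bs σ∈))
  where
  permuted : ∀ {σ} → σ ↭ bs → proj₁ (plug 0 a σ) ⋉ _
  permuted {σ} σ↭bs
    with plug-⋉ {0} ha (All-resp-↭ (↭-sym σ↭bs) hbs) (trans (↭-length σ↭bs) (sym occ≡len))
  ... | t , ht , pl = subst (_⋉ _) (sym (plugsTo⇒plug {0} {a} {σ} pl)) ht

∈-rsubst : ∀ {a us t} → length us ≡ occ 0 a → PlugsTo 0 a us t → t ∈ rsubst a us
∈-rsubst {a} {us} len pl with occ 0 a ≟ length us
... | no occ≢len = ⊥-elim (occ≢len (sym len))
... | yes _ =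
  subst (_∈ _) (plugsTo⇒plug {0} {a} {us} pl) (∈-map⁺ (λ σ → proj₁ (plug 0 a σ)) (self∈perms us))

-- Simulating finite β-reduction

Antecedent : Tree → Tree → RTerm → Set
Antecedent M M' t = Σ[ s ∈ RTerm ] (s ⋉ M × Reduct∋ (_⋉ M') s t)

Antecedents : Tree → Tree → Bag → Set
Antecedents M M' ts = Σ[ ss ∈ Bag ] (All (_⋉ M) ss × Pointwise (Reduct∋ (_⋉ M')) ss ts)

reduct∋-refls : ∀ {Q ts} → All Q ts → Pointwise (Reduct∋ Q) ts ts
reduct∋-refls [] = []
reduct∋-refls (q ∷ qs) = reduct∋-refl q ∷ reduct∋-refls qs

antecedents : ∀ {M M'} → (∀ {t} → t ⋉ M' → Antecedent M M' t) → ∀ {ts} → All (_⋉ M') ts →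
              Antecedents M M' ts
antecedents f [] = [] , [] , []
antecedents f (h ∷ hs) with f h | antecedents f hs
... | s , hs₁ , R | ss , hss , Rs = s ∷ ss , hs₁ ∷ hss , R ∷ Rs

forward-β : ∀ {M M'} → M →β M' → (_⋉ M) ⊆ Reduct (_⋉ M')
forward-β β₀ (app _ (lam _ h) hs) = _ , ⟶*-singleton rβ , rsubst-⋉ h hs
forward-β (lamβ r) (lam _ h) = reduct-lam (forward-β r h)
forward-β (appL r) (app _ h hs) = reduct-app (forward-β r h) (All.map reduct-refl hs)
forward-β (appR r) (app _ h hs) = reduct-app (reduct-refl h) (All.map (forward-β r) hs)

backward-β : ∀ {M M'} → M →β M' → ∀ {t} → t ⋉ M' → Antecedent M M' t
backward-β β₀ h with ⋉-subAt⁻ h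
... | a , us , ha , hus , len , pl =
  rapp (rlam a) us , app refl (lam refl ha) hus ,
  _ , ⟶*-singleton rβ , ∈-rsubst {a} {us} len pl , rsubst-⋉ ha hus
backward-β (lamβ r) (lam _ h) with backward-β r h
... | s , hs , R = rlam s , lam refl hs , reduct∋-lam R
backward-β (appL r) (app _ h hs) with backward-β r h
... | s , h' , R = rapp s _ , app refl h' hs , reduct∋-app R (reduct∋-refls hs)
backward-β (appR r) (app _ h hs) with antecedents (backward-β r) hs
... | ss , hss , Rs = rapp _ ss , app refl h hss , reduct∋-app (reduct∋-refl h) Rs

forward-β* : ∀ {M M'} → M →β* M' → (_⋉ M) ⊆ Reduct (_⋉ M')
forward-β* ε h = reduct-refl h
forward-β* (inj₁ M≈ ◅ rs) h = forward-β* rs (⋉-respʳ-≈ h M≈)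
forward-β* (inj₂ r ◅ rs) h = reduct-trans (forward-β* rs) (forward-β r h)

backward-β* : ∀ {M M'} → M →β* M' → ∀ {t} → t ⋉ M' → Antecedent M M' t
backward-β* ε h = _ , h , reduct∋-refl h
backward-β* (inj₁ M≈ ◅ rs) h with backward-β* rs h
... | s , hs , R = s , ⋉-respʳ-≈ hs (≈-sym M≈) , R
backward-β* (inj₂ r ◅ rs) h with backward-β* rs h
... | s₁ , hs₁ , R₁ with backward-β r hs₁
... | s , hs , R₀ = s , hs , reduct∋-trans (forward-β* rs) R₀ R₁

-- Simulating the infinitary derivation

module _ {N : Tree} {R : Address → Tree} (nodes : ∀ p → Node N R p) (wfN : WF N) where

  subtree-root : ∀ p → subtree p N [] ≡ N p
  subtree-root p = cong N (++-identityʳ p)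

  subtree-root⁻ : ∀ p {l} → subtree p N [] ≡ l → N p ≡ l
  subtree-root⁻ p = trans (sym (subtree-root p))

  subtree-child : ∀ p d → child d (subtree p N) ≈ subtree (p ∷ʳ' d) N
  subtree-child p d q = cong N (sym (++-assoc p (d ∷ []) q))

  childOK : ∀ {p l} → N p ≡ l → ∀ d → ChildOK l (N (p ∷ʳ' d)) d
  childOK {p} e d = subst (λ l → ChildOK l (N (p ∷ʳ' d)) d) e (proj₁ (proj₂ wfN) p d)

  subtree-var : ∀ {p x t} → N p ≡ var x → t ⋉ varT x → t ⋉ subtree p N
  subtree-var {p} e = ⋉-varT⇒ (trans (subtree-root p) e)

  subtree-lam : ∀ {p t} → N p ≡ lam → t ⋉ lamT (subtree (p ∷ʳ' body) N) → t ⋉ subtree p N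
  subtree-lam {p} e = ⋉-lamT⇒ (trans (subtree-root p) e) (≈-sym (subtree-child p body))

  subtree-app : ∀ {p t} → N p ≡ app →
                t ⋉ appT (subtree (p ∷ʳ' left) N) (subtree (p ∷ʳ' right) N) → t ⋉ subtree p N
  subtree-app {p} e =
    ⋉-appT⇒ (trans (subtree-root p) e) (≈-sym (subtree-child p left)) (≈-sym (subtree-child p right))

  ForwardBelow : ℕ → Set
  ForwardBelow n = ∀ p → N p ≢ none → ∀ {s} → size s < n → s ⋉ R p → Reduct (_⋉ subtree p N) s

  forward-lam : ∀ {p n t} → N p ≡ lam → ForwardBelow n → size t ≤ n →
                t ⋉ lamT (R (p ∷ʳ' body)) → Reduct (_⋉ subtree p N) t
  forward-lam {p} e fw sz (lam _ h) =
    reduct-map (subtree-lam e) (reduct-lam (fw (p ∷ʳ' body) (childOK e body) sz h))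

  forward-app : ∀ {p n t} → N p ≡ app → ForwardBelow n → size t ≤ n →
                t ⋉ appT (R (p ∷ʳ' left)) (R (p ∷ʳ' right)) → Reduct (_⋉ subtree p N) t
  forward-app {p} e fw sz (app {s = a} {ts = bs} _ h hs) =
    reduct-map (subtree-app e)
      (reduct-app (fw (p ∷ʳ' left) (childOK e left) (≤-trans (s≤s (m≤m+n _ _)) sz) h)
                  (All.map (λ { (b≤ , hb) → fw (p ∷ʳ' right) (childOK e right) (below b≤) hb })
                           (All.zip (size≤sizeB bs , hs))))
    where
    below : ∀ {b} → size b ≤ sizeB bs → size b < _
    below b≤ = ≤-trans (s≤s (≤-trans b≤ (m≤n+m _ (size a)))) sz

  -- Induction on a bound for size s: reducts are no larger than s, and going
  -- under a λ or into an application strictly shrinks them.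
  forward< : ∀ n → ForwardBelow n
  forward< (suc n) p p≢none (s≤s sz) h with N p in e
  ... | var x = reduct-map (subtree-var e) (forward-β* (proj₁ (nodes p) x e) h)
  ... | lam = reduct-trans (λ (h' , sz') → forward-lam e (forward< n) (≤-trans sz' sz) h')
                           (reduct-size (forward-β* (proj₁ (proj₂ (nodes p)) e) h))
  ... | app = reduct-trans (λ (h' , sz') → forward-app e (forward< n) (≤-trans sz' sz) h')
                           (reduct-size (forward-β* (proj₂ (proj₂ (nodes p)) e) h))
  ... | none = ⊥-elim (p≢none refl)

  forward : ∀ p → N p ≢ none → (_⋉ R p) ⊆ Reduct (_⋉ subtree p N)
  forward p p≢none h = forward< _ p p≢none ≤-refl h

  -- The other summands produced by R p →β* λ.R (p·body) are carried along by
  -- the forward simulation.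
  backward-lam : ∀ {p t} → N p ≡ lam → Antecedent (R (p ∷ʳ' body)) (subtree (p ∷ʳ' body) N) t →
                 Antecedent (R p) (subtree p N) (rlam t)
  backward-lam {p} e (s' , hs' , R') with backward-β* (proj₁ (proj₂ (nodes p)) e) (lam refl hs')
  ... | s , hs , R₀ =
    s , hs , reduct∋-trans (forward-lam e (λ q q≢none _ → forward q q≢none) ≤-refl) R₀
                           (reduct∋-map (subtree-lam e) (reduct∋-lam R'))

  backward-app : ∀ {p t ts} → N p ≡ app → Antecedent (R (p ∷ʳ' left)) (subtree (p ∷ʳ' left) N) t →
                 Antecedents (R (p ∷ʳ' right)) (subtree (p ∷ʳ' right) N) ts →
                 Antecedent (R p) (subtree p N) (rapp t ts)
  backward-app {p} e (a , ha , Ra) (bs , hbs , Rbs)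
    with backward-β* (proj₂ (proj₂ (nodes p)) e) (app refl ha hbs)
  ... | s , hs , R₀ =
    s , hs , reduct∋-trans (forward-app e (λ q q≢none _ → forward q q≢none) ≤-refl) R₀
                           (reduct∋-map (subtree-app e) (reduct∋-app Ra Rbs))

  mutual
    backward : ∀ p {t} → t ⋉ subtree p N → Antecedent (R p) (subtree p N) t
    backward p (var e) with backward-β* (proj₁ (nodes p) _ (subtree-root⁻ p e)) (var refl)
    ... | s , hs , R₀ = s , hs , reduct∋-map (subtree-var (subtree-root⁻ p e)) R₀
    backward p (lam e h) =
      backward-lam (subtree-root⁻ p e) (backward (p ∷ʳ' body) (⋉-respʳ-≈ h (subtree-child p body)))
    backward p (app e h hs) =
      backward-app (subtree-root⁻ p e) (backward (p ∷ʳ' left) (⋉-respʳ-≈ h (subtree-child p left)))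
                   (backward-args p (All⋉-respʳ-≈ hs (subtree-child p right)))

    backward-args : ∀ p {ts} → All (_⋉ subtree (p ∷ʳ' right) N) ts →
                    Antecedents (R (p ∷ʳ' right)) (subtree (p ∷ʳ' right) N) ts
    backward-args p [] = [] , [] , []
    backward-args p (h ∷ hs) with backward (p ∷ʳ' right) h | backward-args p hs
    ... | s , hs₁ , R₁ | ss , hss , Rs = s ∷ ss , hs₁ ∷ hss , R₁ ∷ Rs

theorem4p21 : (M N : Tree) → WF M → WF N → M →β∞ N →
    Σ[ I ∈ Set ] Σ[ s ∈ (I → RTerm) ] Σ[ T ∈ (I → FSum) ]
      ((∀ u → (u ⋉ M) ⇔ (∃[ i ] (u ≅ s i))) ×
       (∀ u → (u ⋉ N) ⇔ (∃[ i ] (u ∈ₛ T i))) ×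
       (∀ i → (s i ∷ []) →r* T i))
theorem4p21 M N _ wfN (R , R[]≈M , nodes) = I , approximant , reduct , taylorM , taylorN , reduces
  where
  -- An index is an approximant of M with a chosen reduct into T(N); the same
  -- approximant may occur with several reducts.
  I : Set
  I = Σ[ s ∈ RTerm ] (s ⋉ M × Reduct (_⋉ N) s)

  approximant : I → RTerm
  approximant (s , _) = s

  reduct : I → FSum
  reduct (_ , _ , S , _) = S

  taylorM : ∀ u → (u ⋉ M) ⇔ (Σ[ i ∈ I ] (u ≅ approximant i))
  taylorM u = mk⇔ (λ h → (u , h , forward nodes wfN [] (proj₁ wfN) (⋉-respʳ-≈ h (≈-sym R[]≈M))) ,
                          ≅-refl u)
                  (λ { ((s , h , _) , u≅s) → ⋉-respˡ-≅ u≅s h })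

  taylorN : ∀ u → (u ⋉ N) ⇔ (Σ[ i ∈ I ] (u ∈ₛ reduct i))
  taylorN u = mk⇔ (λ h → let (s , hs , S , r , u∈S , hS) = backward nodes wfN [] h in
                          (s , ⋉-respʳ-≈ hs R[]≈M , S , r , hS) , Any.map (λ { refl → ≅-refl u }) u∈S)
                  (λ { ((_ , _ , _ , _ , hS) , u∈S) → let (v , v∈S , u≅v) = find u∈S in
                                                       ⋉-respˡ-≅ u≅v (All.lookup hS v∈S) })

  reduces : ∀ i → (approximant i ∷ []) →r* reduct i
  reduces (_ , _ , _ , r , _) = ⟶*⇒→r* r
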